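{- Let $k\ge4$, $n=2k-1$, $\lambda\in\overline{\mathcal{U}}_{T_n}$, let $Y_{S_\lambda}$ be its Keith--Nath Young diagram with hook lengths $h_{i,j}$, and let $z$ be the integer with $h_{1,z+1}=n-2$. Then for every $1\le i\le z$, $h_{i,i}=2\,h_{i,z+1}$.
   Context: Partitions into distinct parts: $\lambda=(\lambda_1<\dots<\lambda_t)$, $t\ge2$. Missing parts $\mathcal{M}_\lambda=\{1,\dots,\lambda_t\}\setminus\{\lambda_i\}$. Unrefinable: no two distinct missing parts sum to a part. Maximal: largest part is maximum among unrefinable partitions of the same integer. $\overline{\mathcal{U}}_N$: maximal unrefinable partitions of $N$ with $\#\mathcal{M}_\lambda=\lfloor\lambda_t/2\rfloor$. $T_n=n(n+1)/2$. $S_\lambda=\mathbb{N}_0\setminus\lambda$; $Y_{S_\lambda}$ (English convention) has one row per part $g$ of $\lambda$, ordered top to bottom by decreasing $g$, the row of $g$ having $\#\{s\in S_\lambda:s<g\}$ cells. $h_{i,j}$ is the hook length (arm + leg + 1) of the cell in row $i$, column $j$. -}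

module Defs where

open import Data.Nat using (ℕ; zero; suc; _+_; _*_; _∸_; _/_; _≤_; _<_; _⊔_; _≟_; _≤?_)
open import Data.Nat.ListAction using (sum)
open import Data.List using (List; []; _∷_; length; filter; reverse; upTo; drop; foldr; map)
open import Data.List.Relation.Unary.All using (All)
open import Data.List.Relation.Unary.Linked using (Linked)
open import Data.List.Membership.Propositional using (_∈_)
open import Data.List.Membership.DecPropositional _≟_ using (_∈?_; _∉?_)
open import Data.Product using (_×_; Σ)
open import Relation.Binary.PropositionalEquality using (_≡_; _≢_)
open import Relation.Nullary using (¬_)

T : ℕ → ℕ
T n = (n * suc n) / 2

IsDistinctPartition : ℕ → List ℕ → Set
IsDistinctPartition N l =
  Linked _<_ l × All (λ p → 1 ≤ p) l × 2 ≤ length l × sum l ≡ N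

largest : List ℕ → ℕ
largest = foldr _⊔_ 0

range1 : ℕ → List ℕ
range1 m = map suc (upTo m)

missing : List ℕ → List ℕ
missing l = filter (_∉? l) (range1 (largest l))

Unrefinable : List ℕ → Set
Unrefinable l = ∀ a b → a ∈ missing l → b ∈ missing l → a ≢ b → ¬ ((a + b) ∈ l)

MaximalUnrefinable : ℕ → List ℕ → Set
MaximalUnrefinable N l =
  IsDistinctPartition N l × Unrefinable l ×
  (∀ μ → IsDistinctPartition N μ → Unrefinable μ → largest μ ≤ largest l)

InUbar : ℕ → List ℕ → Set
InUbar N l = MaximalUnrefinable N l × length (missing l) ≡ largest l / 2

-- Young diagram Y_{S_λ}, given as the list of row lengths (top to bottom):
-- one row per part g of λ, by decreasing g, of length #{s ∈ ℕ₀ \ λ : s < g}.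
rowOf : List ℕ → ℕ → ℕ
rowOf l g = length (filter (_∉? l) (upTo g))

youngRows : List ℕ → List ℕ
youngRows l = map (rowOf l) (reverse l)

-- i-th entry (1-indexed) of a list of row lengths, 0 if out of range
rowLen : List ℕ → ℕ → ℕ
rowLen []       _             = 0
rowLen (r ∷ rs) zero          = 0
rowLen (r ∷ rs) (suc zero)    = r
rowLen (r ∷ rs) (suc (suc i)) = rowLen rs (suc i)

Cell : List ℕ → ℕ → ℕ → Set
Cell rs i j = 1 ≤ i × 1 ≤ j × j ≤ rowLen rs i

arm : List ℕ → ℕ → ℕ → ℕ
arm rs i j = rowLen rs i ∸ j

leg : List ℕ → ℕ → ℕ → ℕ
leg rs i j = length (filter (j ≤?_) (drop i rs))

hook : List ℕ → ℕ → ℕ → ℕ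
hook rs i j = arm rs i j + leg rs i j + 1

-- Let m be the largest part of λ and c = n − 2. The unrefinable partition 1, …, c − 1, c + 3, 2c of T_n
-- shows m ≥ 2c. By unrefinability each pair {a, m − a} contains at most one missing part; since there are
-- ⌊m/2⌋ of them, every pair contains exactly one (and so does the middle m/2 when m is even). Adding the
-- parts pairwise gives T_n = m + T_h + (the excesses b − a of the pairs whose larger member b is a part),
-- where m = 2h + 1 or 2h + 2, and this forces m = 2c. Hence c is a gap and, for x < c, x is a gap exactly
-- when 2c − x is a part.
-- In Y_{S_λ} the part g lies in row #{parts ≥ g}, that row has #{gaps < g} cells, and its cell in the
-- column of a gap s < g has hook length g − s. So h_{1,z+1} = c puts column z + 1 at the gap c, and row
-- i ≤ z belongs to the part 2c − s for the i-th gap s, whose cell in the column of s is the diagonal one: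
-- h_{i,i} = 2c − 2s and h_{i,z+1} = c − s.
module Submission where

open import Data.Nat
open import Data.Nat.Properties
open import Data.Nat.DivMod using (m≡m%n+[m/n]*n; m%n<n; m*n/n≡m; +-distrib-/-∣ʳ)
open import Data.Nat.Divisibility using (divides)
open import Data.Nat.ListAction using (sum)
open import Data.Nat.ListAction.Properties using (sum-++; sum-↭)
open import Data.Nat.Tactic.RingSolver using (solve-∀)
open import Algebra.Properties.CommutativeSemigroup +-commutativeSemigroup using (interchange; x∙yz≈y∙xz; xy∙z≈xz∙y)
open import Data.List using (List; []; _∷_; _∷ʳ_; _++_; [_]; map; filter; length; drop; upTo; downFrom; reverse)
open import Data.List.Properties
  using (map-∘; map-id; reverse-map; reverse-upTo; unfold-reverse; ++-identityʳ; length-++;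
         filter-++; filter-accept; filter-reject; filter-all; filter-none)
open import Data.List.Relation.Binary.Permutation.Propositional.Properties using (↭-reverse)
open import Data.List.Relation.Unary.All as All using (All; []; _∷_)
import Data.List.Relation.Unary.All.Properties as All
open import Data.List.Relation.Unary.AllPairs using ([]; _∷_)
import Data.List.Relation.Unary.AllPairs.Properties as AllPairs
open import Data.List.Relation.Unary.Any using (here; there)
open import Data.List.Relation.Unary.Any.Properties using (reverse⁺)
open import Data.List.Relation.Unary.Linked using (Linked; []; [-]; _∷_; tail)
import Data.List.Relation.Unary.Linked as Linked
import Data.List.Relation.Unary.Linked.Properties as Linked
open import Data.List.Membership.Propositional using (_∈_; _∉_)
open import Data.List.Membership.Propositional.Properties
  using (∈-filter⁺; ∈-filter⁻; ∈-map⁺; ∈-map⁻; ∈-upTo⁺; ∈-upTo⁻; ∈-++⁺ˡ; ∈-++⁺ʳ)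
open import Data.List.Membership.DecPropositional _≟_ using (_∈?_; _∉?_)
open import Data.Product using (∃; ∃₂; ∃-syntax; _×_; _,_; proj₁; proj₂)
open import Data.Sum using (_⊎_; inj₁; inj₂)
open import Function using (_∘_; id; flip; _⇔_; mk⇔; Equivalence)
open import Level using (Level)
open import Relation.Nullary using (Dec; yes; no; ¬_; contradiction)
open import Relation.Unary using (Pred; Decidable)
open import Relation.Binary.Core using (Rel)
open import Relation.Binary.Definitions using (Transitive; tri<; tri≈; tri>)
open import Relation.Binary.PropositionalEquality
  using (_≡_; _≢_; refl; sym; trans; cong; cong₂; subst; subst₂; module ≡-Reasoning)
open import Defs

-- Sums over initial segments and indicators

∑ : ℕ → (ℕ → ℕ) → ℕ
∑ zero    f = 0
∑ (suc n) f = f n + ∑ n f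

syntax ∑ n (λ y → e) = ∑[ y < n ] e

module _ {f g : ℕ → ℕ} where

  ∑-cong : ∀ n → (∀ y → y < n → f y ≡ g y) → ∑ n f ≡ ∑ n g
  ∑-cong zero    _  = refl
  ∑-cong (suc n) eq = cong₂ _+_ (eq n ≤-refl) (∑-cong n (λ y y<n → eq y (m<n⇒m<1+n y<n)))

  ∑-distrib-+ : ∀ n → ∑[ y < n ] (f y + g y) ≡ ∑ n f + ∑ n g
  ∑-distrib-+ zero    = refl
  ∑-distrib-+ (suc n) = trans (cong (f n + g n +_) (∑-distrib-+ n)) (interchange (f n) (g n) (∑ n f) (∑ n g))

∑-const : ∀ n c → ∑[ _ < n ] c ≡ n * c
∑-const zero    c = refl
∑-const (suc n) c = cong (c +_) (∑-const n c)

∑-zero : ∀ {f} n → (∀ y → y < n → f y ≡ 0) → ∑ n f ≡ 0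
∑-zero {f} n f≡0 = trans (∑-cong n f≡0) (trans (∑-const n 0) (*-zeroʳ n))

∑-split : ∀ f a b → ∑ (a + b) f ≡ ∑ a f + ∑[ t < b ] f (a + t)
∑-split f a zero    = trans (cong (λ n → ∑ n f) (+-identityʳ a)) (sym (+-identityʳ (∑ a f)))
∑-split f a (suc b) = begin
  ∑ (a + suc b) f                               ≡⟨ cong (λ n → ∑ n f) (+-suc a b) ⟩
  f (a + b) + ∑ (a + b) f                       ≡⟨ cong (f (a + b) +_) (∑-split f a b) ⟩
  f (a + b) + (∑ a f + ∑[ t < b ] f (a + t))    ≡⟨ x∙yz≈y∙xz (f (a + b)) (∑ a f) _ ⟩
  ∑ a f + (f (a + b) + ∑[ t < b ] f (a + t))    ∎
  where open ≡-Reasoning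

∑-suc-shift : ∀ f n → ∑ (suc n) f ≡ f 0 + ∑[ t < n ] f (suc t)
∑-suc-shift f n = trans (∑-split f 1 n) (cong (_+ ∑[ t < n ] f (suc t)) (+-identityʳ (f 0)))

∑-reflect : ∀ f n → ∑ n f ≡ ∑[ y < n ] f (n ∸ suc y)
∑-reflect f zero    = refl
∑-reflect f (suc n) =
  trans (cong (f n +_) (∑-reflect f n)) (sym (∑-suc-shift (λ y → f (suc n ∸ suc y)) n))

∑-fold : ∀ f h r → ∑ (h + r + h) f ≡ ∑[ y < h ] (f y + f (h + r + h ∸ suc y)) + ∑[ y < r ] f (h + y)
∑-fold f h r = begin
  ∑ (h + r + h) f                                              ≡⟨ ∑-split f (h + r) h ⟩
  ∑ (h + r) f + ∑[ t < h ] f (h + r + t)                      ≡⟨ cong₂ _+_ (∑-split f h r) upper ⟩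
  ∑ h f + middle + ∑[ y < h ] f (h + r + h ∸ suc y)           ≡⟨ xy∙z≈xz∙y (∑ h f) middle _ ⟩
  ∑ h f + ∑[ y < h ] f (h + r + h ∸ suc y) + middle           ≡⟨ cong (_+ middle) (∑-distrib-+ h) ⟨
  ∑[ y < h ] (f y + f (h + r + h ∸ suc y)) + middle           ∎
  where
  open ≡-Reasoning
  middle = ∑[ y < r ] f (h + y)
  upper : ∑[ t < h ] f (h + r + t) ≡ ∑[ y < h ] f (h + r + h ∸ suc y)
  upper = trans (∑-reflect (λ t → f (h + r + t)) h)
                (∑-cong h (λ y y<h → cong f (sym (+-∸-assoc (h + r) y<h))))

∑-window : ∀ {f} n a d → a + d ≤ n → (∀ y → y < a → f y ≡ 0) → (∀ y → a + d ≤ y → y < n → f y ≡ 0) →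
           ∑ n f ≡ ∑[ t < d ] f (a + t)
∑-window {f} n a d a+d≤n below above with m≤n⇒∃[o]m+o≡n a+d≤n
... | e , refl = begin
  ∑ (a + d + e) f                                         ≡⟨ ∑-split f (a + d) e ⟩
  ∑ (a + d) f + ∑[ t < e ] f (a + d + t)                 ≡⟨ cong₂ _+_ (∑-split f a d) (∑-zero e (λ t t<e → above _ (m≤m+n (a + d) t) (+-monoʳ-< (a + d) t<e))) ⟩
  ∑ a f + ∑[ t < d ] f (a + t) + 0                       ≡⟨ +-identityʳ _ ⟩
  ∑ a f + ∑[ t < d ] f (a + t)                           ≡⟨ cong (_+ ∑[ t < d ] f (a + t)) (∑-zero a below) ⟩
  ∑[ t < d ] f (a + t)                                   ∎
  where open ≡-Reasoning

+-tight : ∀ {a b p q} → a ≤ p → b ≤ q → a + b ≡ p + q → a ≡ p × b ≡ q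
+-tight {a} {b} {p} {q} a≤p b≤q eq = a≡p , +-cancelˡ-≡ p b q (trans (cong (_+ b) (sym a≡p)) eq)
  where
  a≡p : a ≡ p
  a≡p = ≤-antisym a≤p (+-cancelʳ-≤ q p a (≤-trans (≤-reflexive (sym eq)) (+-monoʳ-≤ a b≤q)))

∑-≤1 : ∀ {f} n → (∀ y → y < n → f y ≤ 1) → ∑ n f ≤ n
∑-≤1 zero    _  = z≤n
∑-≤1 (suc n) ≤1 = +-mono-≤ (≤1 n ≤-refl) (∑-≤1 n (λ y y<n → ≤1 y (m<n⇒m<1+n y<n)))

∑-saturated : ∀ {f} n → (∀ y → y < n → f y ≤ 1) → ∑ n f ≡ n → ∀ y → y < n → f y ≡ 1
∑-saturated {f} (suc n) ≤1 eq y y<1+n = split (m≤n⇒m<n∨m≡n (s≤s⁻¹ y<1+n))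
  where
  ≤1′ : ∀ y → y < n → f y ≤ 1
  ≤1′ y y<n = ≤1 y (m<n⇒m<1+n y<n)
  tight : f n ≡ 1 × ∑ n f ≡ n
  tight = +-tight (≤1 n ≤-refl) (∑-≤1 n ≤1′) eq
  split : y < n ⊎ y ≡ n → f y ≡ 1
  split (inj₁ y<n) = ∑-saturated n ≤1′ (proj₂ tight) y y<n
  split (inj₂ refl) = proj₁ tight

∑-zero-or-≥ : ∀ {f} n k → (∀ y → y < n → f y ≡ 0 ⊎ k ≤ f y) → ∑ n f ≡ 0 ⊎ k ≤ ∑ n f
∑-zero-or-≥ zero    k _ = inj₁ refl
∑-zero-or-≥ {f} (suc n) k cases with cases n ≤-refl | ∑-zero-or-≥ n k (λ y y<n → cases y (m<n⇒m<1+n y<n))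
... | inj₁ fn≡0 | inj₁ ∑≡0 = inj₁ (cong₂ _+_ fn≡0 ∑≡0)
... | inj₁ fn≡0 | inj₂ k≤∑ = inj₂ (≤-trans k≤∑ (m≤n+m (∑ n f) (f n)))
... | inj₂ k≤fn | _         = inj₂ (≤-trans k≤fn (m≤m+n (f n) (∑ n f)))

private variable
  a p : Level
  A : Set a

indicator : Dec A → ℕ
indicator (yes _) = 1
indicator (no _)  = 0

indicator-yes : {d : Dec A} → A → indicator d ≡ 1
indicator-yes {d = yes _} _ = refl
indicator-yes {d = no ¬x} x = contradiction x ¬x

indicator-no : {d : Dec A} → ¬ A → indicator d ≡ 0
indicator-no {d = yes x} ¬x = contradiction x ¬x
indicator-no {d = no _}  _  = refl

indicator-cong : ∀ {b} {B : Set b} → A ⇔ B → {d : Dec A} {e : Dec B} → indicator d ≡ indicator e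
indicator-cong _   {yes _} {yes _} = refl
indicator-cong _   {no _}  {no _}  = refl
indicator-cong A⇔B {yes x} {no ¬y} = contradiction (Equivalence.to A⇔B x) ¬y
indicator-cong A⇔B {no ¬x} {yes y} = contradiction (Equivalence.from A⇔B y) ¬x

module _ {P : Pred ℕ p} (P? : Decidable P) where

  sum-map-filter : ∀ f xs → sum (map f (filter P? xs)) ≡ sum (map (λ y → indicator (P? y) * f y) xs)
  sum-map-filter f []       = refl
  sum-map-filter f (x ∷ xs) with P? x
  ... | yes _ = cong₂ _+_ (sym (+-identityʳ (f x))) (sum-map-filter f xs)
  ... | no _  = sum-map-filter f xs

  length-filter≡sum : ∀ xs → length (filter P? xs) ≡ sum (map (λ y → indicator (P? y)) xs)
  length-filter≡sum []       = refl
  length-filter≡sum (x ∷ xs) with P? x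
  ... | yes _ = cong suc (length-filter≡sum xs)
  ... | no _  = length-filter≡sum xs

sum-map-downFrom : ∀ f n → sum (map f (downFrom n)) ≡ ∑ n f
sum-map-downFrom f zero    = refl
sum-map-downFrom f (suc n) = cong (f n +_) (sum-map-downFrom f n)

sum-map-upTo : ∀ f n → sum (map f (upTo n)) ≡ ∑ n f
sum-map-upTo f n = begin
  sum (map f (upTo n))             ≡⟨ sum-↭ (↭-reverse (map f (upTo n))) ⟨
  sum (reverse (map f (upTo n)))   ≡⟨ cong sum (reverse-map f (upTo n)) ⟨
  sum (map f (reverse (upTo n)))   ≡⟨ cong (sum ∘ map f) (reverse-upTo n) ⟩
  sum (map f (downFrom n))         ≡⟨ sum-map-downFrom f n ⟩
  ∑ n f                            ∎
  where open ≡-Reasoning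

-- Strictly increasing lists

Linked-head⇒All : ∀ {r} {R : Rel ℕ r} → Transitive R → ∀ {x xs} → Linked R (x ∷ xs) → All (R x) xs
Linked-head⇒All R-trans [-]           = []
Linked-head⇒All R-trans (Rxy ∷ y∷ys) = Linked.Linked⇒All R-trans Rxy y∷ys

strictlySorted-≡ : ∀ {xs ys} → Linked _<_ xs → Linked _<_ ys →
                   (∀ {z} → z ∈ xs → z ∈ ys) → (∀ {z} → z ∈ ys → z ∈ xs) → xs ≡ ys
strictlySorted-≡ {[]}     {[]}     _  _  _  _  = refl
strictlySorted-≡ {[]}     {y ∷ _}  _  _  _  ⊇ with () ← ⊇ (here refl)
strictlySorted-≡ {x ∷ _}  {[]}     _  _  ⊆  _ with () ← ⊆ (here refl)
strictlySorted-≡ {x ∷ xs} {y ∷ ys} sx sy ⊆ ⊇ =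
  cong₂ _∷_ x≡y (strictlySorted-≡ (tail sx) (tail sy) ⊆-tail ⊇-tail)
  where
  head<∈ : ∀ {z zs} → Linked _<_ (z ∷ zs) → ∀ {y} → y ∈ zs → z < y
  head<∈ sorted = All.lookup (Linked-head⇒All <-trans sorted)
  x≡y : x ≡ y
  x≡y with ⊆ (here refl) | ⊇ (here refl)
  ... | here x≡y | _          = x≡y
  ... | there _  | here y≡x   = sym y≡x
  ... | there x∈ | there y∈   = contradiction (head<∈ sy x∈) (<-asym (head<∈ sx y∈))
  ⊆-tail : ∀ {z} → z ∈ xs → z ∈ ys
  ⊆-tail z∈ with ⊆ (there z∈)
  ... | here z≡y = contradiction (trans x≡y (sym z≡y)) (<⇒≢ (head<∈ sx z∈))
  ... | there z∈ys = z∈ys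
  ⊇-tail : ∀ {z} → z ∈ ys → z ∈ xs
  ⊇-tail z∈ with ⊇ (there z∈)
  ... | here z≡x = contradiction (trans (sym x≡y) (sym z≡x)) (<⇒≢ (head<∈ sy z∈))
  ... | there z∈xs = z∈xs

module _ {P : Pred ℕ p} (P? : Decidable P) where

  reverse-filter : ∀ xs → reverse (filter P? xs) ≡ filter P? (reverse xs)
  reverse-filter []       = refl
  reverse-filter (x ∷ xs) = begin
    reverse (filter P? (x ∷ xs))                ≡⟨ reverse-filter-∷ ⟩
    reverse (filter P? xs) ++ filter P? [ x ]   ≡⟨ cong (_++ filter P? [ x ]) (reverse-filter xs) ⟩
    filter P? (reverse xs) ++ filter P? [ x ]   ≡⟨ filter-++ P? (reverse xs) [ x ] ⟨
    filter P? (reverse xs ∷ʳ x)                 ≡⟨ cong (filter P?) (unfold-reverse x xs) ⟨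
    filter P? (reverse (x ∷ xs))                ∎
    where
    open ≡-Reasoning
    reverse-filter-∷ : reverse (filter P? (x ∷ xs)) ≡ reverse (filter P? xs) ++ filter P? [ x ]
    reverse-filter-∷ with P? x
    ... | yes _ = unfold-reverse x (filter P? xs)
    ... | no _  = sym (++-identityʳ _)

module _ {l : List ℕ} (sorted : Linked _<_ l) {n : ℕ} (bounded : ∀ {x} → x ∈ l → x < n) where

  sorted≡filter-upTo : l ≡ filter (_∈? l) (upTo n)
  sorted≡filter-upTo = strictlySorted-≡ sorted (Linked.filter⁺ (_∈? l) <-trans (Linked.applyUpTo⁺₂ _ n n<1+n))
    (λ x∈ → ∈-filter⁺ (_∈? l) (∈-upTo⁺ (bounded x∈)) x∈)
    (λ x∈ → proj₂ (∈-filter⁻ (_∈? l) {xs = upTo n} x∈))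

  reverse-sorted≡filter-downFrom : reverse l ≡ filter (_∈? l) (downFrom n)
  reverse-sorted≡filter-downFrom = begin
    reverse l                              ≡⟨ cong reverse sorted≡filter-upTo ⟩
    reverse (filter (_∈? l) (upTo n))      ≡⟨ reverse-filter (_∈? l) (upTo n) ⟩
    filter (_∈? l) (reverse (upTo n))      ≡⟨ cong (filter (_∈? l)) (reverse-upTo n) ⟩
    filter (_∈? l) (downFrom n)            ∎
    where open ≡-Reasoning

∈⇒≤largest : ∀ {x xs} → x ∈ xs → x ≤ largest xs
∈⇒≤largest {xs = y ∷ ys} (here refl) = m≤m⊔n y (largest ys)
∈⇒≤largest {xs = y ∷ ys} (there x∈)  = ≤-trans (∈⇒≤largest x∈) (m≤n⊔m y (largest ys))

largest-∈ : ∀ x xs → largest (x ∷ xs) ∈ x ∷ xs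
largest-∈ x []       = here (⊔-identityʳ x)
largest-∈ x (y ∷ ys) with ⊔-sel x (largest (y ∷ ys))
... | inj₁ x⊔≡x = here x⊔≡x
... | inj₂ x⊔≡m = there (subst (_∈ y ∷ ys) (sym x⊔≡m) (largest-∈ y ys))

-- Gaps of a partition

module Gaps (l : List ℕ) where

  [∈] [∉] : ℕ → ℕ
  [∈] y = indicator (y ∈? l)
  [∉] y = indicator (y ∉? l)

  gaps : ℕ → ℕ
  gaps n = ∑[ y < n ] [∉] y

  rowOf≡gaps : ∀ n → rowOf l n ≡ gaps n
  rowOf≡gaps n = trans (length-filter≡sum (_∉? l) (upTo n)) (sum-map-upTo [∉] n)

  [∉]+[∈]≡1 : ∀ y → [∉] y + [∈] y ≡ 1
  [∉]+[∈]≡1 y with y ∈? l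
  ... | yes _ = refl
  ... | no _  = refl

  [∉]≤1 : ∀ y → [∉] y ≤ 1
  [∉]≤1 y with y ∈? l
  ... | yes _ = z≤n
  ... | no _  = ≤-refl

  [∈]≤1 : ∀ y → [∈] y ≤ 1
  [∈]≤1 y with y ∈? l
  ... | yes _ = ≤-refl
  ... | no _  = z≤n

  [∉]-∉ : ∀ {y} → y ∉ l → [∉] y ≡ 1
  [∉]-∉ {y} y∉ with y ∈? l
  ... | yes y∈ = contradiction y∈ y∉
  ... | no _   = refl

  [∉]-∈ : ∀ {y} → y ∈ l → [∉] y ≡ 0
  [∉]-∈ {y} y∈ with y ∈? l
  ... | yes _  = refl
  ... | no y∉  = contradiction y∈ y∉

  [∉]≡1⇒∉ : ∀ {y} → [∉] y ≡ 1 → y ∉ l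
  [∉]≡1⇒∉ {y} [∉]y≡1 with y ∈? l
  ... | yes _ with () ← [∉]y≡1
  ... | no y∉ = y∉

  [∈]-∉ : ∀ {y} → y ∉ l → [∈] y ≡ 0
  [∈]-∉ {y} y∉ with y ∈? l
  ... | yes y∈ = contradiction y∈ y∉
  ... | no _   = refl

  [∈]-∈ : ∀ {y} → y ∈ l → [∈] y ≡ 1
  [∈]-∈ {y} y∈ with y ∈? l
  ... | yes _  = refl
  ... | no y∉  = contradiction y∈ y∉

  gaps-suc-∉ : ∀ {s} → s ∉ l → gaps (suc s) ≡ suc (gaps s)
  gaps-suc-∉ {s} s∉ = cong (_+ gaps s) ([∉]-∉ s∉)

  gaps-mono : ∀ {a b} → a ≤ b → gaps a ≤ gaps b
  gaps-mono {a} a≤b with m≤n⇒∃[o]m+o≡n a≤b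
  ... | d , refl = ≤-trans (m≤m+n (gaps a) _) (≤-reflexive (sym (∑-split [∉] a d)))

  gap-of-rank : ∀ n {z} → z < gaps n → ∃[ s ] s < n × s ∉ l × gaps s ≡ z
  gap-of-rank (suc n) {z} z< with z <? gaps n
  ... | yes z<gn with s , s<n , s∉ , gs≡z ← gap-of-rank n z<gn = s , m<n⇒m<1+n s<n , s∉ , gs≡z
  ... | no z≮gn with n ∈? l
  ...   | yes _ = contradiction z< z≮gn
  ...   | no n∉ = n , ≤-refl , n∉ , ≤-antisym (≮⇒≥ z≮gn) (s≤s⁻¹ z<)

  length-missing≡∑ : length (missing l) ≡ ∑[ y < largest l ] [∉] (suc y)
  length-missing≡∑ = begin
    length (filter (_∉? l) (map suc (upTo m)))   ≡⟨ length-filter≡sum (_∉? l) (map suc (upTo m)) ⟩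
    sum (map [∉] (map suc (upTo m)))             ≡⟨ cong sum (map-∘ (upTo m)) ⟨
    sum (map (λ y → [∉] (suc y)) (upTo m))       ≡⟨ sum-map-upTo (λ y → [∉] (suc y)) m ⟩
    ∑[ y < m ] [∉] (suc y)                       ∎
    where
    open ≡-Reasoning
    m = largest l

  sum≡∑[∈] : Linked _<_ l → sum l ≡ ∑[ y < suc (largest l) ] ([∈] y * y)
  sum≡∑[∈] sorted = begin
    sum l                                          ≡⟨ cong sum (map-id l) ⟨
    sum (map (λ y → y) l)                          ≡⟨ cong (sum ∘ map (λ y → y)) (sorted≡filter-upTo sorted (s≤s ∘ ∈⇒≤largest)) ⟩
    sum (map (λ y → y) (filter (_∈? l) (upTo n)))  ≡⟨ sum-map-filter (_∈? l) (λ y → y) (upTo n) ⟩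
    sum (map (λ y → [∈] y * y) (upTo n))           ≡⟨ sum-map-upTo (λ y → [∈] y * y) n ⟩
    ∑[ y < n ] ([∈] y * y)                           ∎
    where
    open ≡-Reasoning
    n = suc (largest l)

  ∈-missing : ∀ {x} → 1 ≤ x → x ≤ largest l → x ∉ l → x ∈ missing l
  ∈-missing {suc x} _ x<m x∉ = ∈-filter⁺ (_∉? l) (∈-map⁺ suc (∈-upTo⁺ x<m)) x∉

  gap-pair≤1 : Unrefinable l → ∀ {a b} → 1 ≤ a → a < b → a + b ∈ l → [∉] a + [∉] b ≤ 1
  gap-pair≤1 unrefinable {a} {b} 1≤a a<b a+b∈ with a ∈? l | b ∈? l
  ... | yes _ | yes _ = z≤n
  ... | yes _ | no _  = ≤-refl
  ... | no _  | yes _ = ≤-refl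
  ... | no a∉ | no b∉ = contradiction a+b∈ (unrefinable a b
        (∈-missing 1≤a (≤-trans (m≤m+n a b) a+b≤m) a∉)
        (∈-missing (≤-trans 1≤a (<⇒≤ a<b)) (≤-trans (m≤n+m b a) a+b≤m) b∉)
        (<⇒≢ a<b))
    where a+b≤m = ∈⇒≤largest a+b∈

  one-gap⇒gap⇔part : ∀ {a b} → [∉] a + [∉] b ≡ 1 → a ∉ l ⇔ b ∈ l
  one-gap⇒gap⇔part {a} {b} one with a ∈? l | b ∈? l
  ... | yes a∈ | no b∉  = mk⇔ (λ a∉ → contradiction a∈ a∉) (λ b∈ → contradiction b∈ b∉)
  ... | no a∉  | yes b∈ = mk⇔ (λ _ → b∈) (λ _ → a∉)
  ... | yes _  | yes _  with () ← one
  ... | no _   | no _   with () ← one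

  one-gap⇒pair-sum : ∀ {a b} → [∉] a + [∉] b ≡ 1 → a ≤ b → [∈] a * a + [∈] b * b ≡ a + [∈] b * (b ∸ a)
  one-gap⇒pair-sum {a} {b} one a≤b with a ∈? l | b ∈? l
  ... | yes _ | no _  = +-identityʳ (a + 0)
  ... | no _  | yes _ = trans (+-identityʳ b) (sym (trans (cong (a +_) (+-identityʳ (b ∸ a))) (m+[n∸m]≡n a≤b)))
  ... | yes _ | yes _ with () ← one
  ... | no _  | no _  with () ← one

-- Rows and hooks of the Keith–Nath diagram

∈⇒1≤length : ∀ {x : ℕ} {xs} → x ∈ xs → 1 ≤ length xs
∈⇒1≤length (here _)  = s≤s z≤n
∈⇒1≤length (there _) = s≤s z≤n

rowLen-∷ : ∀ r rs {i} → 1 ≤ i → rowLen (r ∷ rs) (suc i) ≡ rowLen rs i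
rowLen-∷ r rs (s≤s z≤n) = refl

position : List ℕ → ℕ → ℕ
position d g = length (filter (g ≤?_) d)

module _ (f : ℕ → ℕ) where

  rowLen-map-position : ∀ {d g} → Linked _>_ d → g ∈ d → rowLen (map f d) (position d g) ≡ f g
  rowLen-map-position {x ∷ xs} desc (here refl)
    rewrite filter-accept (x ≤?_) {xs = xs} (≤-refl {x})
          | filter-none (x ≤?_) (All.map <⇒≱ (Linked-head⇒All (flip <-trans) desc)) = refl
  rowLen-map-position {x ∷ xs} {g} desc (there g∈)
    rewrite filter-accept (g ≤?_) {xs = xs} (<⇒≤ (All.lookup (Linked-head⇒All (flip <-trans) desc) g∈)) =
    trans (rowLen-∷ (f x) (map f xs) (∈⇒1≤length (∈-filter⁺ (g ≤?_) g∈ ≤-refl)))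
          (rowLen-map-position (tail desc) g∈)

  drop-map-position : ∀ {d g} → Linked _>_ d → g ∈ d → drop (position d g) (map f d) ≡ map f (filter (_<? g) d)
  drop-map-position {x ∷ xs} desc (here refl)
    rewrite filter-accept (x ≤?_) {xs = xs} (≤-refl {x})
          | filter-none (x ≤?_) (All.map <⇒≱ (Linked-head⇒All (flip <-trans) desc))
          | filter-reject (_<? x) {xs = xs} (<-irrefl refl)
          | filter-all (_<? x) (Linked-head⇒All (flip <-trans) desc) = refl
  drop-map-position {x ∷ xs} {g} desc (there g∈) with All.lookup (Linked-head⇒All (flip <-trans) desc) g∈
  ... | g<x rewrite filter-accept (g ≤?_) {xs = xs} (<⇒≤ g<x)
                  | filter-reject (_<? g) {xs = xs} (<-asym g<x) = drop-map-position (tail desc) g∈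

rowIndex : List ℕ → ℕ → ℕ
rowIndex l g = position (reverse l) g

module YoungDiagram {l : List ℕ} (sorted : Linked _<_ l) where

  open Gaps l

  private
    m = largest l

    reverse≡descending : reverse l ≡ filter (_∈? l) (downFrom (suc m))
    reverse≡descending = reverse-sorted≡filter-downFrom sorted (s≤s ∘ ∈⇒≤largest)

    descending : Linked _>_ (reverse l)
    descending = subst (Linked _>_) (sym reverse≡descending)
      (Linked.filter⁺ (_∈? l) (flip <-trans) (Linked.applyDownFrom⁺₂ id (suc m) n<1+n))

  sum-over-parts : ∀ f → sum (map f (reverse l)) ≡ ∑[ y < suc m ] ([∈] y * f y)
  sum-over-parts f = begin
    sum (map f (reverse l))                                ≡⟨ cong (sum ∘ map f) reverse≡descending ⟩
    sum (map f (filter (_∈? l) (downFrom (suc m))))        ≡⟨ sum-map-filter (_∈? l) f (downFrom (suc m)) ⟩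
    sum (map (λ y → [∈] y * f y) (downFrom (suc m)))       ≡⟨ sum-map-downFrom (λ y → [∈] y * f y) (suc m) ⟩
    ∑[ y < suc m ] ([∈] y * f y)                           ∎
    where open ≡-Reasoning

  rowLen-rowIndex : ∀ {g} → g ∈ l → rowLen (youngRows l) (rowIndex l g) ≡ gaps g
  rowLen-rowIndex {g} g∈ = trans (rowLen-map-position (rowOf l) descending (reverse⁺ g∈)) (rowOf≡gaps g)

  rowIndex≡ : ∀ {g} → g ≤ m → rowIndex l g ≡ ∑[ t < suc (m ∸ g) ] [∈] (m ∸ t)
  rowIndex≡ {g} g≤m = begin
    length (filter (g ≤?_) (reverse l))                ≡⟨ length-filter≡sum (g ≤?_) (reverse l) ⟩
    sum (map (λ y → indicator (g ≤? y)) (reverse l))   ≡⟨ sum-over-parts (λ y → indicator (g ≤? y)) ⟩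
    ∑[ y < suc m ] F y                                 ≡⟨ ∑-reflect F (suc m) ⟩
    ∑[ t < suc m ] F (m ∸ t)                           ≡⟨ ∑-window (suc m) 0 (suc (m ∸ g)) (s≤s (m∸n≤m m g)) (λ _ ()) above ⟩
    ∑[ t < suc (m ∸ g) ] F (m ∸ t)                     ≡⟨ ∑-cong (suc (m ∸ g)) inside ⟩
    ∑[ t < suc (m ∸ g) ] [∈] (m ∸ t)                   ∎
    where
    open ≡-Reasoning
    F : ℕ → ℕ
    F y = [∈] y * indicator (g ≤? y)
    m∸[m∸g]≡g = m∸[m∸n]≡n g≤m
    above : ∀ t → suc (m ∸ g) ≤ t → t < suc m → F (m ∸ t) ≡ 0
    above t m∸g<t t≤m = trans (cong ([∈] (m ∸ t) *_) (indicator-no (<⇒≱ m∸t<g))) (*-zeroʳ ([∈] (m ∸ t)))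
      where m∸t<g = subst (m ∸ t <_) m∸[m∸g]≡g (∸-monoʳ-< m∸g<t (s≤s⁻¹ t≤m))
    inside : ∀ t → t < suc (m ∸ g) → F (m ∸ t) ≡ [∈] (m ∸ t)
    inside t t≤m∸g = trans (cong ([∈] (m ∸ t) *_) (indicator-yes g≤m∸t)) (*-identityʳ ([∈] (m ∸ t)))
      where g≤m∸t = subst (_≤ m ∸ t) m∸[m∸g]≡g (∸-monoʳ-≤ m (s≤s⁻¹ t≤m∸g))

  arm-at-gap : ∀ {s d} → suc s + d ∈ l → s ∉ l →
               arm (youngRows l) (rowIndex l (suc s + d)) (suc (gaps s)) ≡ ∑[ t < d ] [∉] (suc s + t)
  arm-at-gap {s} {d} g∈ s∉ = begin
    rowLen (youngRows l) (rowIndex l (suc s + d)) ∸ suc (gaps s)   ≡⟨ cong (_∸ suc (gaps s)) (rowLen-rowIndex g∈) ⟩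
    gaps (suc s + d) ∸ suc (gaps s)                                ≡⟨ cong (_∸ suc (gaps s)) (∑-split [∉] (suc s) d) ⟩
    gaps (suc s) + between ∸ suc (gaps s)                          ≡⟨ cong (λ n → n + between ∸ suc (gaps s)) (gaps-suc-∉ s∉) ⟩
    suc (gaps s) + between ∸ suc (gaps s)                          ≡⟨ m+n∸m≡n (suc (gaps s)) between ⟩
    between                                                        ∎
    where
    open ≡-Reasoning
    between = ∑[ t < d ] [∉] (suc s + t)

  leg≡∑ : ∀ {g} j → g ∈ l →
          leg (youngRows l) (rowIndex l g) j ≡ ∑[ y < suc m ] ([∈] y * (indicator (y <? g) * indicator (j ≤? rowOf l y)))
  leg≡∑ {g} j g∈ = begin
    length (filter (j ≤?_) (drop (rowIndex l g) (youngRows l)))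
      ≡⟨ cong (length ∘ filter (j ≤?_)) (drop-map-position (rowOf l) descending (reverse⁺ g∈)) ⟩
    length (filter (j ≤?_) (map (rowOf l) below-g))
      ≡⟨ length-filter≡sum (j ≤?_) (map (rowOf l) below-g) ⟩
    sum (map (λ r → indicator (j ≤? r)) (map (rowOf l) below-g))
      ≡⟨ cong sum (map-∘ below-g) ⟨
    sum (map (λ y → indicator (j ≤? rowOf l y)) below-g)
      ≡⟨ sum-map-filter (_<? g) (λ y → indicator (j ≤? rowOf l y)) (reverse l) ⟩
    sum (map (λ y → indicator (y <? g) * indicator (j ≤? rowOf l y)) (reverse l))
      ≡⟨ sum-over-parts (λ y → indicator (y <? g) * indicator (j ≤? rowOf l y)) ⟩
    ∑[ y < suc m ] ([∈] y * (indicator (y <? g) * indicator (j ≤? rowOf l y)))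
      ∎
    where
    open ≡-Reasoning
    below-g = filter (_<? g) (reverse l)

  leg-at-gap : ∀ {s d} → suc s + d ∈ l → s ∉ l →
               leg (youngRows l) (rowIndex l (suc s + d)) (suc (gaps s)) ≡ ∑[ t < d ] [∈] (suc s + t)
  leg-at-gap {s} {d} g∈ s∉ =
    trans (leg≡∑ j g∈) (trans (∑-window (suc m) (suc s) d (m≤n⇒m≤1+n (∈⇒≤largest g∈)) below above) (∑-cong d inside))
    where
    g = suc s + d
    j = suc (gaps s)
    F : ℕ → ℕ
    F y = [∈] y * (indicator (y <? g) * indicator (j ≤? rowOf l y))
    below : ∀ y → y < suc s → F y ≡ 0
    below y y≤s = trans (cong (λ b → [∈] y * (indicator (y <? g) * b)) (indicator-no {d = j ≤? rowOf l y} j≰))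
                        (trans (cong ([∈] y *_) (*-zeroʳ (indicator (y <? g)))) (*-zeroʳ ([∈] y)))
      where
      j≰ : ¬ j ≤ rowOf l y
      j≰ j≤ = <⇒≱ (≤-trans j≤ (≤-trans (≤-reflexive (rowOf≡gaps y)) (gaps-mono (s≤s⁻¹ y≤s)))) ≤-refl
    above : ∀ y → g ≤ y → y < suc m → F y ≡ 0
    above y g≤y _ = trans (cong (λ a → [∈] y * (a * indicator (j ≤? rowOf l y))) (indicator-no {d = y <? g} (≤⇒≯ g≤y)))
                          (*-zeroʳ ([∈] y))
    inside : ∀ t → t < d → F (suc s + t) ≡ [∈] (suc s + t)
    inside t t<d = trans (cong₂ (λ a b → [∈] (suc s + t) * (a * b))
                                (indicator-yes {d = suc s + t <? g} (+-monoʳ-< (suc s) t<d))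
                                (indicator-yes {d = j ≤? rowOf l (suc s + t)} j≤))
                         (*-identityʳ ([∈] (suc s + t)))
      where
      j≤ : j ≤ rowOf l (suc s + t)
      j≤ = subst₂ _≤_ (gaps-suc-∉ s∉) (sym (rowOf≡gaps (suc s + t))) (gaps-mono (m≤m+n (suc s) t))

  hook-at-gap : ∀ {g s} → g ∈ l → s ∉ l → s < g → hook (youngRows l) (rowIndex l g) (suc (gaps s)) ≡ g ∸ s
  hook-at-gap {g} {s} g∈ s∉ s<g with m≤n⇒∃[o]m+o≡n s<g
  ... | d , refl = begin
    arm (youngRows l) (rowIndex l g) j + leg (youngRows l) (rowIndex l g) j + 1
      ≡⟨ cong₂ (λ a b → a + b + 1) (arm-at-gap {s} {d} g∈ s∉) (leg-at-gap {s} {d} g∈ s∉) ⟩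
    ∑[ t < d ] [∉] (suc s + t) + ∑[ t < d ] [∈] (suc s + t) + 1
      ≡⟨ cong (_+ 1) (∑-distrib-+ d) ⟨
    ∑[ t < d ] ([∉] (suc s + t) + [∈] (suc s + t)) + 1
      ≡⟨ cong (_+ 1) (trans (∑-cong d (λ t _ → [∉]+[∈]≡1 (suc s + t))) (trans (∑-const d 1) (*-identityʳ d))) ⟩
    d + 1
      ≡⟨ +-comm d 1 ⟩
    suc d
      ≡⟨ m+n∸m≡n s (suc d) ⟨
    s + suc d ∸ s
      ≡⟨ cong (_∸ s) (+-suc s d) ⟩
    suc s + d ∸ s
      ∎
    where
    open ≡-Reasoning
    j = suc (gaps s)

-- A lower bound for the largest part

triangle : ℕ → ℕ
triangle n = ∑[ y < n ] suc y

T≡triangle : ∀ n → T n ≡ triangle n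
T≡triangle n = trans (cong (_/ 2) (double n)) (m*n/n≡m (triangle n) 2)
  where
  double : ∀ n → n * suc n ≡ triangle n * 2
  double zero    = refl
  double (suc n) = begin
    suc n * suc (suc n)          ≡⟨ step n ⟩
    suc n * 2 + n * suc n        ≡⟨ cong (suc n * 2 +_) (double n) ⟩
    suc n * 2 + triangle n * 2   ≡⟨ *-distribʳ-+ 2 (suc n) (triangle n) ⟨
    triangle (suc n) * 2         ∎
    where
    open ≡-Reasoning
    step : ∀ n → suc n * suc (suc n) ≡ suc n * 2 + n * suc n
    step = solve-∀

triangle-mono : ∀ {a b} → a ≤ b → triangle a ≤ triangle b
triangle-mono {a} a≤b with d , refl ← m≤n⇒∃[o]m+o≡n a≤b =
  ≤-trans (m≤m+n (triangle a) _) (≤-reflexive (sym (∑-split suc a d)))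

range1-bounds : ∀ {n x} → x ∈ range1 n → 1 ≤ x × x ≤ n
range1-bounds x∈ with i , i∈ , refl ← ∈-map⁻ suc x∈ = s≤s z≤n , ∈-upTo⁻ i∈

∈-range1 : ∀ {n x} → 1 ≤ x → x ≤ n → x ∈ range1 n
∈-range1 {x = suc i} _ i<n = ∈-map⁺ suc (∈-upTo⁺ i<n)

module _ (c′ : ℕ) where

  private
    c = suc c′

  -- All gaps of this partition of T (2 + c) are at least c, so it is unrefinable.
  witness : List ℕ
  witness = range1 c′ ++ c + 3 ∷ c + c ∷ []

  module _ (4≤c : 4 ≤ c) where

    c+3<c+c : c + 3 < c + c
    c+3<c+c = +-monoʳ-< c 4≤c

    witness-partition : IsDistinctPartition (T (2 + c)) witness
    witness-partition = sorted , positive , two-parts , total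
      where
      sorted : Linked _<_ witness
      sorted = Linked.AllPairs⇒Linked (AllPairs.++⁺
        (Linked.Linked⇒AllPairs <-trans (Linked.map⁺ (Linked.map s≤s (Linked.applyUpTo⁺₂ _ c′ n<1+n))))
        ((c+3<c+c ∷ []) ∷ [] ∷ [])
        (All.tabulate (λ x∈ → let x≤c′ = proj₂ (range1-bounds x∈) in
          ≤-trans (s≤s x≤c′) (m≤m+n c 3) ∷ ≤-trans (s≤s x≤c′) (m≤m+n c c) ∷ [])))
      positive : All (1 ≤_) witness
      positive = All.++⁺ (All.tabulate (λ x∈ → proj₁ (range1-bounds x∈))) (s≤s z≤n ∷ s≤s z≤n ∷ [])
      two-parts : 2 ≤ length witness
      two-parts = subst (2 ≤_) (sym (length-++ (range1 c′))) (m≤n+m 2 (length (range1 c′)))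
      total : sum witness ≡ T (2 + c)
      total = begin
        sum witness                                ≡⟨ sum-++ (range1 c′) (c + 3 ∷ c + c ∷ []) ⟩
        sum (range1 c′) + (c + 3 + (c + c + 0))    ≡⟨ cong (_+ (c + 3 + (c + c + 0))) (sum-map-upTo suc c′) ⟩
        triangle c′ + (c + 3 + (c + c + 0))        ≡⟨ arithmetic c′ (triangle c′) ⟩
        triangle (2 + c)                           ≡⟨ T≡triangle (2 + c) ⟨
        T (2 + c)                                  ∎
        where
        open ≡-Reasoning
        arithmetic : ∀ c′ t → t + (suc c′ + 3 + (suc c′ + suc c′ + 0)) ≡ 3 + c′ + (2 + c′ + (1 + c′ + t))
        arithmetic = solve-∀

    private
      c≤gap : ∀ {a} → a ∈ missing witness → c ≤ a
      c≤gap {a} a∈ with ∈-filter⁻ (_∉? witness) {xs = range1 (largest witness)} a∈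
      ... | a∈range , a∉ with a ≤? c′
      ...   | yes a≤c′ = contradiction (∈-++⁺ˡ (∈-range1 (proj₁ (range1-bounds a∈range)) a≤c′)) a∉
      ...   | no a≰c′  = ≰⇒> a≰c′

      parts≤c+c : All (_≤ c + c) witness
      parts≤c+c = All.++⁺ (All.tabulate (λ x∈ → ≤-trans (proj₂ (range1-bounds x∈)) (≤-trans (n≤1+n c′) (m≤m+n c c))))
                          (<⇒≤ c+3<c+c ∷ ≤-refl ∷ [])

    witness-unrefinable : Unrefinable witness
    witness-unrefinable a b a∈ b∈ a≢b a+b∈ =
      <⇒≱ (distinct-sum (c≤gap a∈) (c≤gap b∈) a≢b) (All.lookup parts≤c+c a+b∈)
      where
      distinct-sum : ∀ {a b} → c ≤ a → c ≤ b → a ≢ b → c + c < a + b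
      distinct-sum {a} {b} c≤a c≤b a≢b with <-cmp a b
      ... | tri< a<b _ _ = +-mono-≤-< c≤a (≤-<-trans c≤a a<b)
      ... | tri≈ _ a≡b _ = contradiction a≡b a≢b
      ... | tri> _ _ b<a = +-mono-<-≤ (≤-<-trans c≤b b<a) c≤b

largest-lower-bound : ∀ {c l} → 4 ≤ c → MaximalUnrefinable (T (2 + c)) l → c + c ≤ largest l
largest-lower-bound {suc c′} 4≤c (_ , _ , maximal) =
  ≤-trans (∈⇒≤largest (∈-++⁺ʳ (range1 c′) (there (here refl))))
          (maximal (witness c′) (witness-partition c′ 4≤c) (witness-unrefinable c′ 4≤c))

-- The largest part of a partition in Ū

record MirrorPaired (c : ℕ) (l : List ℕ) : Set where
  field
    largest≡ : largest l ≡ c + c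
    c∉       : c ∉ l
    gap⇔part : ∀ {x} → x < c → x ∉ l ⇔ c + c ∸ x ∈ l

parity-split : ∀ n → ∃₂ λ h r → r ≤ 1 × n ≡ h + r + h
parity-split n = n / 2 , n % 2 , s≤s⁻¹ (m%n<n n 2) , trans (m≡m%n+[m/n]*n n 2) (rearrange (n % 2) (n / 2))
  where
  rearrange : ∀ r h → r + h * 2 ≡ h + r + h
  rearrange = solve-∀

half-of-suc : ∀ h {r} → r ≤ 1 → suc (h + r + h) / 2 ≡ h + r
half-of-suc h {0} z≤n = begin
  suc (h + 0 + h) / 2          ≡⟨ cong (_/ 2) (rearrange h) ⟩
  (1 + h * 2) / 2              ≡⟨ +-distrib-/-∣ʳ 1 {d = 2} (divides h refl) ⟩
  1 / 2 + h * 2 / 2            ≡⟨ m*n/n≡m h 2 ⟩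
  h                            ≡⟨ +-identityʳ h ⟨
  h + 0                        ∎
  where
  open ≡-Reasoning
  rearrange : ∀ h → suc (h + 0 + h) ≡ 1 + h * 2
  rearrange = solve-∀
half-of-suc h {1} (s≤s z≤n) = trans (cong (_/ 2) (rearrange h)) (m*n/n≡m (h + 1) 2)
  where
  rearrange : ∀ h → suc (h + 1 + h) ≡ (h + 1) * 2
  rearrange = solve-∀

1+[h+1+h]≡[1+h]+[1+h] : ∀ h → suc (h + 1 + h) ≡ suc h + suc h
1+[h+1+h]≡[1+h]+[1+h] = solve-∀

zero-or-≥ : ∀ {e j k} → e ≤ 1 → j ≤ k → e * k ≡ 0 ⊎ j ≤ e * k
zero-or-≥ z≤n               _   = inj₁ refl
zero-or-≥ {k = k} (s≤s z≤n) j≤k = inj₂ (≤-trans j≤k (≤-reflexive (sym (+-identityʳ k))))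

excess-≢2 : ∀ {r e rest} → r ≤ 1 → e ≤ 1 → rest ≡ 0 ⊎ 3 ≤ rest → r + (e * suc r + rest) ≢ 2
excess-≢2 {r} {e} {rest} _ _ (inj₂ 3≤rest) eq =
  <⇒≱ (n<1+n 2) (subst (3 ≤_) eq (≤-trans 3≤rest (≤-trans (m≤n+m rest (e * suc r)) (m≤n+m _ r))))
excess-≢2 z≤n       z≤n       (inj₁ refl) ()
excess-≢2 z≤n       (s≤s z≤n) (inj₁ refl) ()
excess-≢2 (s≤s z≤n) z≤n       (inj₁ refl) ()
excess-≢2 (s≤s z≤n) (s≤s z≤n) (inj₁ refl) ()

-- With m = 1 + (h + r + h), the numbers 1, …, m − 1 split into the pairs {y + 1, m − (y + 1)} for y < h
-- and, when r = 1, the middle h + 1. Here m − (y + 1) is written n ∸ y.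
module Pairing {l : List ℕ} (sorted : Linked _<_ l) (unrefinable : Unrefinable l)
               (#missing : length (missing l) ≡ largest l / 2) (largest∈ : largest l ∈ l)
               {h r : ℕ} (r≤1 : r ≤ 1) (largest≡ : largest l ≡ suc (h + r + h)) where

  open Gaps l

  private
    n = h + r + h

    <h⇒<n : ∀ {y} → y < h → y < n
    <h⇒<n y<h = <-≤-trans y<h (≤-trans (m≤m+n h r) (m≤m+n (h + r) h))

  mirror-offset : ∀ {y d} → h ≡ suc (y + d) → n ∸ y ≡ suc y + suc (d + d + r)
  mirror-offset {y} {d} refl = trans (cong (_∸ y) (rearrange y d r)) (m+n∸m≡n y _)
    where
    rearrange : ∀ y d r → suc (y + d) + r + suc (y + d) ≡ y + (suc y + suc (d + d + r))
    rearrange = solve-∀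

  mirror : ∀ {y} → y < h → suc y < n ∸ y × suc y + (n ∸ y) ≡ largest l
  mirror {y} y<h with d , h≡ ← m≤n⇒∃[o]m+o≡n y<h =
    subst (suc y <_) (sym offset) (m<m+n (suc y) (s≤s z≤n)) ,
    trans (cong suc (m+[n∸m]≡n (<⇒≤ (<h⇒<n y<h)))) (sym largest≡)
    where offset = mirror-offset {y} {d} (sym h≡)

  private
    top∈ : suc n ∈ l
    top∈ = subst (_∈ l) largest≡ largest∈

  interior-fold : ∀ (φ : ℕ → ℕ) → ∑[ y < n ] φ (suc y) ≡ ∑[ y < h ] (φ (suc y) + φ (n ∸ y)) + ∑[ y < r ] φ (suc (h + y))
  interior-fold φ = trans (∑-fold (λ y → φ (suc y)) h r)
    (cong (_+ ∑[ y < r ] φ (suc (h + y)))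
          (∑-cong h (λ y y<h → cong (λ b → φ (suc y) + φ b) (sym (+-∸-assoc 1 (<h⇒<n y<h))))))

  gaps-in-pair : ℕ → ℕ
  gaps-in-pair y = [∉] (suc y) + [∉] (n ∸ y)

  gap-count : ∑[ y < h ] gaps-in-pair y + ∑[ y < r ] [∉] (suc (h + y)) ≡ h + r
  gap-count = begin
    ∑[ y < h ] gaps-in-pair y + ∑[ y < r ] [∉] (suc (h + y))   ≡⟨ interior-fold [∉] ⟨
    ∑[ y < n ] [∉] (suc y)                                     ≡⟨ cong (_+ ∑[ y < n ] [∉] (suc y)) ([∉]-∈ top∈) ⟨
    ∑[ y < suc n ] [∉] (suc y)                                 ≡⟨ cong (λ k → ∑[ y < k ] [∉] (suc y)) largest≡ ⟨
    ∑[ y < largest l ] [∉] (suc y)                             ≡⟨ length-missing≡∑ ⟨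
    length (missing l)                                         ≡⟨ #missing ⟩
    largest l / 2                                              ≡⟨ cong (_/ 2) largest≡ ⟩
    suc n / 2                                                  ≡⟨ half-of-suc h r≤1 ⟩
    h + r                                                      ∎
    where open ≡-Reasoning

  gaps-in-pair≤1 : ∀ y → y < h → gaps-in-pair y ≤ 1
  gaps-in-pair≤1 y y<h with a<b , a+b≡m ← mirror y<h =
    gap-pair≤1 unrefinable (s≤s z≤n) a<b (subst (_∈ l) (sym a+b≡m) largest∈)

  private
    middle≤1 : ∀ y → y < r → [∉] (suc (h + y)) ≤ 1
    middle≤1 y _ = [∉]≤1 (suc (h + y))

    saturated : (∀ y → y < h → gaps-in-pair y ≡ 1) × (∀ y → y < r → [∉] (suc (h + y)) ≡ 1)
    saturated with pairs≡h , middle≡r ← +-tight (∑-≤1 h gaps-in-pair≤1) (∑-≤1 r middle≤1) gap-count =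
      ∑-saturated h gaps-in-pair≤1 pairs≡h , ∑-saturated r middle≤1 middle≡r

  one-gap-per-pair : ∀ y → y < h → gaps-in-pair y ≡ 1
  one-gap-per-pair = proj₁ saturated

  middle-gap : ∀ y → y < r → suc (h + y) ∉ l
  middle-gap y y<r = [∉]≡1⇒∉ (proj₂ saturated y y<r)

  excess : ℕ → ℕ
  excess y = [∈] (n ∸ y) * (n ∸ y ∸ suc y)

  part-sum : sum l ≡ suc n + (triangle h + ∑[ y < h ] excess y)
  part-sum = begin
    sum l
      ≡⟨ sum≡∑[∈] sorted ⟩
    ∑[ y < suc (largest l) ] ([∈] y * y)
      ≡⟨ cong (λ k → ∑[ y < suc k ] ([∈] y * y)) largest≡ ⟩
    [∈] (suc n) * suc n + ∑[ y < suc n ] ([∈] y * y)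
      ≡⟨ cong₂ _+_ (trans (cong (_* suc n) ([∈]-∈ top∈)) (+-identityʳ (suc n))) (∑-suc-shift (λ y → [∈] y * y) n) ⟩
    suc n + ([∈] 0 * 0 + ∑[ y < n ] ([∈] (suc y) * suc y))
      ≡⟨ cong (λ z → suc n + (z + ∑[ y < n ] ([∈] (suc y) * suc y))) (*-zeroʳ ([∈] 0)) ⟩
    suc n + ∑[ y < n ] ([∈] (suc y) * suc y)
      ≡⟨ cong (suc n +_) (interior-fold (λ a → [∈] a * a)) ⟩
    suc n + (∑[ y < h ] ([∈] (suc y) * suc y + [∈] (n ∸ y) * (n ∸ y)) + ∑[ y < r ] ([∈] (suc (h + y)) * suc (h + y)))
      ≡⟨ cong₂ (λ a b → suc n + (a + b)) (∑-cong h pair-sum) (∑-zero r middle-sum) ⟩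
    suc n + (∑[ y < h ] (suc y + excess y) + 0)
      ≡⟨ cong (suc n +_) (trans (+-identityʳ _) (∑-distrib-+ h)) ⟩
    suc n + (triangle h + ∑[ y < h ] excess y)
      ∎
    where
    open ≡-Reasoning
    pair-sum : ∀ y → y < h → [∈] (suc y) * suc y + [∈] (n ∸ y) * (n ∸ y) ≡ suc y + excess y
    pair-sum y y<h = one-gap⇒pair-sum (one-gap-per-pair y y<h) (<⇒≤ (proj₁ (mirror y<h)))
    middle-sum : ∀ y → y < r → [∈] (suc (h + y)) * suc (h + y) ≡ 0
    middle-sum y y<r = cong (_* suc (h + y)) ([∈]-∉ (middle-gap y y<r))

  excess≡ : ∀ {y d} → h ≡ suc (y + d) → excess y ≡ [∈] (n ∸ y) * suc (d + d + r)
  excess≡ {y} {d} h≡ = cong ([∈] (n ∸ y) *_) (trans (cong (_∸ suc y) (mirror-offset h≡)) (m+n∸m≡n (suc y) _))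

  excess-total : sum l ≡ T (2 + h) → r + ∑[ y < h ] excess y ≡ 2
  excess-total sum≡ = +-cancelʳ-≡ (suc (h + h) + triangle h) _ 2 (begin
    r + ∑[ y < h ] excess y + (suc (h + h) + triangle h)  ≡⟨ rearrange h r (triangle h) (∑[ y < h ] excess y) ⟩
    suc n + (triangle h + ∑[ y < h ] excess y)            ≡⟨ part-sum ⟨
    sum l                                                 ≡⟨ trans sum≡ (T≡triangle (2 + h)) ⟩
    triangle (2 + h)                                      ≡⟨ rearrange′ h (triangle h) ⟩
    2 + (suc (h + h) + triangle h)                        ∎)
    where
    open ≡-Reasoning
    rearrange : ∀ h r t e → r + e + (suc (h + h) + t) ≡ suc (h + r + h) + (t + e)
    rearrange = solve-∀
    rearrange′ : ∀ h t → suc (suc h) + (suc h + t) ≡ 2 + (suc (h + h) + t)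
    rearrange′ = solve-∀

  excess-far : ∀ {h′} → h ≡ suc h′ → ∑[ y < h′ ] excess y ≡ 0 ⊎ 3 ≤ ∑[ y < h′ ] excess y
  excess-far {h′} h≡1+h′ = ∑-zero-or-≥ h′ 3 (λ y y<h′ → far-pair y (m≤n⇒∃[o]m+o≡n y<h′))
    where
    three+ : ∀ d r → 3 + (d + d + r) ≡ suc (suc d + suc d + r)
    three+ = solve-∀
    far-pair : ∀ y → ∃ (λ d → suc y + d ≡ h′) → excess y ≡ 0 ⊎ 3 ≤ excess y
    far-pair y (d , 1+y+d≡h′) = subst (λ e → e ≡ 0 ⊎ 3 ≤ e) (sym (excess≡ {y} {suc d} h≡1+y+1+d))
      (zero-or-≥ ([∈]≤1 (n ∸ y)) (≤-trans (m≤m+n 3 (d + d + r)) (≤-reflexive (three+ d r))))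
      where h≡1+y+1+d = trans h≡1+h′ (cong suc (trans (sym 1+y+d≡h′) (sym (+-suc y d))))

  -- If h = c the excesses add up to 2 − r, but the pair nearest the middle has excess 0 or 1 + r and every
  -- other pair 0 or at least 3.
  sum≢T[2+h] : 1 ≤ h → sum l ≢ T (2 + h)
  sum≢T[2+h] 1≤h sum≡ = excess-≢2 r≤1 ([∈]≤1 (n ∸ h′)) (excess-far h≡1+h′) (begin
    r + ([∈] (n ∸ h′) * suc r + ∑[ y < h′ ] excess y)  ≡⟨ cong (λ e → r + (e + ∑[ y < h′ ] excess y)) (excess≡ {h′} {0} h≡1+h′+0) ⟨
    r + ∑[ y < suc h′ ] excess y                        ≡⟨ cong (λ k → r + ∑[ y < k ] excess y) h≡1+h′ ⟨
    r + ∑[ y < h ] excess y                             ≡⟨ excess-total sum≡ ⟩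
    2                                                   ∎)
    where
    open ≡-Reasoning
    h′ = pred h
    h≡1+h′ : h ≡ suc h′
    h≡1+h′ = sym (suc-pred h {{>-nonZero 1≤h}})
    h≡1+h′+0 : h ≡ suc (h′ + 0)
    h≡1+h′+0 = trans h≡1+h′ (cong suc (sym (+-identityʳ h′)))

  sum≢T[2+c] : ∀ {c} → c < h → sum l ≢ T (2 + c)
  sum≢T[2+c] {c} c<h sum≡ = <⇒≢ (begin-strict
    T (2 + c)                                      ≡⟨ T≡triangle (2 + c) ⟩
    suc (suc c) + triangle (suc c)                 <⟨ +-monoˡ-< (triangle (suc c)) (s≤s (m<m+n (suc c) z<s)) ⟩
    suc (suc c + suc c) + triangle (suc c)         ≤⟨ +-mono-≤ (s≤s (+-mono-≤ c<h c<h)) (triangle-mono c<h) ⟩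
    suc (h + h) + triangle h                       ≤⟨ +-monoˡ-≤ (triangle h) (s≤s (+-monoˡ-≤ h (m≤m+n h r))) ⟩
    suc n + triangle h                             ≤⟨ +-monoʳ-≤ (suc n) (m≤m+n (triangle h) _) ⟩
    suc n + (triangle h + ∑[ y < h ] excess y)     ≡⟨ part-sum ⟨
    sum l                                          ∎) (sym sum≡)
    where open ≤-Reasoning

  mirrorPaired-at-middle : 0 ∉ l → suc h + suc h ≤ largest l → MirrorPaired (suc h) l
  mirrorPaired-at-middle 0∉ bound = record
    { largest≡ = trans largest≡ (cong suc n≡)
    ; c∉       = subst (_∉ l) (cong suc (+-identityʳ h)) (middle-gap 0 1≤r)
    ; gap⇔part = gap⇔part
    }
    where
    1≤r : 1 ≤ r
    1≤r = +-cancelˡ-≤ h 1 r (+-cancelʳ-≤ h (h + 1) (h + r) (s≤s⁻¹ (begin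
      suc (h + 1 + h)   ≡⟨ 1+[h+1+h]≡[1+h]+[1+h] h ⟩
      suc h + suc h     ≤⟨ bound ⟩
      largest l         ≡⟨ largest≡ ⟩
      suc (h + r + h)   ∎)))
      where open ≤-Reasoning
    n≡ : n ≡ h + suc h
    n≡ = trans (cong (λ r → h + r + h) (≤-antisym r≤1 1≤r)) (rearrange h)
      where
      rearrange : ∀ h → h + 1 + h ≡ h + suc h
      rearrange = solve-∀
    gap⇔part : ∀ {x} → x < suc h → x ∉ l ⇔ suc h + suc h ∸ x ∈ l
    gap⇔part {zero}  _       = mk⇔ (λ _ → subst (_∈ l) (trans largest≡ (cong suc n≡)) largest∈) (λ _ → 0∉)
    gap⇔part {suc y} 1+y<1+h = subst (λ b → suc y ∉ l ⇔ b ∈ l) (cong (_∸ y) n≡) (one-gap⇒gap⇔part (one-gap-per-pair y (s≤s⁻¹ 1+y<1+h)))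

mirrorPaired : ∀ {c l} → 4 ≤ c → InUbar (T (2 + c)) l → MirrorPaired c l
mirrorPaired {c} {[]} _ (((_ , _ , () , _) , _) , _)
mirrorPaired {c} {x ∷ xs} 4≤c (maximal@((sorted , positive , _ , total) , unrefinable , _) , #missing)
  with h , r , r≤1 , pred≡ ← parity-split (pred (largest (x ∷ xs))) = classify (m≤n⇒m<n∨m≡n c≤1+h)
  where
  l = x ∷ xs
  largest∈ : largest l ∈ l
  largest∈ = largest-∈ x xs
  largest≡ : largest l ≡ suc (h + r + h)
  largest≡ = trans (sym (suc-pred (largest l) {{>-nonZero (All.lookup positive largest∈)}})) (cong suc pred≡)
  open Pairing sorted unrefinable #missing largest∈ {h} {r} r≤1 largest≡
  c+c≤ : c + c ≤ largest l
  c+c≤ = largest-lower-bound 4≤c maximal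
  c≤1+h : c ≤ suc h
  c≤1+h = ≮⇒≥ (λ 1+h<c → <⇒≱ (+-mono-< 1+h<c 1+h<c) (begin
    c + c             ≤⟨ c+c≤ ⟩
    largest l         ≡⟨ largest≡ ⟩
    suc (h + r + h)   ≤⟨ s≤s (+-monoˡ-≤ h (+-monoʳ-≤ h r≤1)) ⟩
    suc (h + 1 + h)   ≡⟨ 1+[h+1+h]≡[1+h]+[1+h] h ⟩
    suc h + suc h     ∎))
    where open ≤-Reasoning
  0∉ : 0 ∉ l
  0∉ 0∈ = contradiction (All.lookup positive 0∈) λ ()
  classify : c < suc h ⊎ c ≡ suc h → MirrorPaired c l
  classify (inj₂ c≡1+h) =
    subst (λ c → MirrorPaired c l) (sym c≡1+h) (mirrorPaired-at-middle 0∉ (subst (λ c → c + c ≤ largest l) c≡1+h c+c≤))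
  classify (inj₁ (s≤s c≤h)) with m≤n⇒m<n∨m≡n c≤h
  ... | inj₁ c<h = contradiction total (sum≢T[2+c] c<h)
  ... | inj₂ c≡h = contradiction (subst (λ c → sum l ≡ T (2 + c)) c≡h total)
                                 (sum≢T[2+h] (≤-trans (s≤s z≤n) (subst (4 ≤_) c≡h 4≤c)))

-- Hooks of the diagram

double-distance : ∀ {c s} → s ≤ c → c + c ∸ s ∸ s ≡ 2 * (c + c ∸ s ∸ c)
double-distance {c} {s} s≤c = begin
  c + c ∸ s ∸ s           ≡⟨ cong (_∸ s) (+-∸-assoc c s≤c) ⟩
  c + (c ∸ s) ∸ s         ≡⟨ cong (_∸ s) (+-comm c (c ∸ s)) ⟩
  (c ∸ s) + c ∸ s         ≡⟨ +-∸-assoc (c ∸ s) s≤c ⟩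
  (c ∸ s) + (c ∸ s)       ≡⟨ cong ((c ∸ s) +_) (+-identityʳ (c ∸ s)) ⟨
  2 * (c ∸ s)             ≡⟨ cong (2 *_) (m+n∸m≡n c (c ∸ s)) ⟨
  2 * (c + (c ∸ s) ∸ c)   ≡⟨ cong (λ g → 2 * (g ∸ c)) (+-∸-assoc c s≤c) ⟨
  2 * (c + c ∸ s ∸ c)     ∎
  where open ≡-Reasoning

module Hooks {c : ℕ} {l : List ℕ} (sorted : Linked _<_ l) (largest∈ : largest l ∈ l) (paired : MirrorPaired c l) where

  open MirrorPaired paired
  open Gaps l
  open YoungDiagram sorted

  private
    rows = youngRows l

  rowIndex-largest : rowIndex l (largest l) ≡ 1
  rowIndex-largest = begin
    rowIndex l (largest l)                                  ≡⟨ rowIndex≡ ≤-refl ⟩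
    ∑[ t < suc (largest l ∸ largest l) ] [∈] (largest l ∸ t) ≡⟨ cong (λ k → ∑[ t < suc k ] [∈] (largest l ∸ t)) (n∸n≡0 (largest l)) ⟩
    [∈] (largest l) + 0                                     ≡⟨ cong (_+ 0) ([∈]-∈ largest∈) ⟩
    1                                                       ∎
    where open ≡-Reasoning

  rowIndex-mirror : ∀ {s} → s < c → s ∉ l → rowIndex l (c + c ∸ s) ≡ suc (gaps s)
  rowIndex-mirror {s} s<c s∉ = begin
    rowIndex l (c + c ∸ s)
      ≡⟨ rowIndex≡ (subst (c + c ∸ s ≤_) (sym largest≡) (m∸n≤m (c + c) s)) ⟩
    ∑[ t < suc (largest l ∸ (c + c ∸ s)) ] [∈] (largest l ∸ t)
      ≡⟨ cong (λ m → ∑[ t < suc (m ∸ (c + c ∸ s)) ] [∈] (m ∸ t)) largest≡ ⟩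
    ∑[ t < suc (c + c ∸ (c + c ∸ s)) ] [∈] (c + c ∸ t)
      ≡⟨ cong (λ k → ∑[ t < suc k ] [∈] (c + c ∸ t)) (m∸[m∸n]≡n (≤-trans (<⇒≤ s<c) (m≤m+n c c))) ⟩
    ∑[ t < suc s ] [∈] (c + c ∸ t)
      ≡⟨ ∑-cong (suc s) (λ t t≤s → indicator-cong (gap⇔part (≤-<-trans (s≤s⁻¹ t≤s) s<c))) ⟨
    gaps (suc s)
      ≡⟨ gaps-suc-∉ s∉ ⟩
    suc (gaps s)
      ∎
    where open ≡-Reasoning

  rowLen-top : rowLen rows 1 ≡ gaps (largest l)
  rowLen-top = trans (cong (rowLen rows) (sym rowIndex-largest)) (rowLen-rowIndex largest∈)

  column-of-c : ∀ {z} → suc z ≤ rowLen rows 1 → hook rows 1 (suc z) ≡ c → z ≡ gaps c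
  column-of-c {z} z<row hook≡c with s , s<m , s∉ , gaps-s≡z ← gap-of-rank (largest l) (subst (suc z ≤_) rowLen-top z<row) =
    trans (sym gaps-s≡z) (cong gaps s≡c)
    where
    m∸s≡c : largest l ∸ s ≡ c
    m∸s≡c = begin
      largest l ∸ s                                   ≡⟨ hook-at-gap largest∈ s∉ s<m ⟨
      hook rows (rowIndex l (largest l)) (suc (gaps s)) ≡⟨ cong₂ (hook rows) rowIndex-largest (cong suc gaps-s≡z) ⟩
      hook rows 1 (suc z)                             ≡⟨ hook≡c ⟩
      c                                               ∎
      where open ≡-Reasoning
    s≡c : s ≡ c
    s≡c = begin
      s                              ≡⟨ m∸[m∸n]≡n (<⇒≤ s<m) ⟨
      largest l ∸ (largest l ∸ s)    ≡⟨ cong₂ _∸_ largest≡ m∸s≡c ⟩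
      c + c ∸ c                      ≡⟨ m+n∸n≡m c c ⟩
      c                              ∎
      where open ≡-Reasoning

  mirror-row-doubles : ∀ {s} → s < c → s ∉ l →
                       let k = rowIndex l (c + c ∸ s) in
                       Cell rows k (suc (gaps c)) × hook rows k k ≡ 2 * hook rows k (suc (gaps c))
  mirror-row-doubles {s} s<c s∉ = cell , hooks
    where
    g = c + c ∸ s
    k = rowIndex l g
    g∈ : g ∈ l
    g∈ = Equivalence.to (gap⇔part s<c) s∉
    c<g : c < g
    c<g = subst (c <_) (sym (+-∸-assoc c (<⇒≤ s<c))) (m<m+n c (m<n⇒0<n∸m s<c))
    cell : Cell rows k (suc (gaps c))
    cell = subst (1 ≤_) (sym (rowIndex-mirror s<c s∉)) (s≤s z≤n) , s≤s z≤n ,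
           subst₂ _≤_ (gaps-suc-∉ c∉) (sym (rowLen-rowIndex g∈)) (gaps-mono c<g)
    hooks : hook rows k k ≡ 2 * hook rows k (suc (gaps c))
    hooks = begin
      hook rows k k                        ≡⟨ cong (hook rows k) (rowIndex-mirror s<c s∉) ⟩
      hook rows k (suc (gaps s))           ≡⟨ hook-at-gap g∈ s∉ (<-trans s<c c<g) ⟩
      g ∸ s                                ≡⟨ double-distance (<⇒≤ s<c) ⟩
      2 * (g ∸ c)                          ≡⟨ cong (2 *_) (hook-at-gap g∈ c∉ c<g) ⟨
      2 * hook rows k (suc (gaps c))       ∎
      where open ≡-Reasoning

  diagonal-hook : ∀ {z} → suc z ≤ rowLen rows 1 → hook rows 1 (suc z) ≡ c →
                  ∀ i → 1 ≤ i → i ≤ z → Cell rows i (suc z) × hook rows i i ≡ 2 * hook rows i (suc z)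
  diagonal-hook {z} z<row hook≡c (suc i) _ i<z = from-gap (gap-of-rank c (subst (suc i ≤_) z≡gaps-c i<z))
    where
    z≡gaps-c = column-of-c z<row hook≡c
    from-gap : ∃[ s ] s < c × s ∉ l × gaps s ≡ i →
               Cell rows (suc i) (suc z) × hook rows (suc i) (suc i) ≡ 2 * hook rows (suc i) (suc z)
    from-gap (s , s<c , s∉ , gaps-s≡i) =
      subst₂ (λ k z → Cell rows k (suc z) × hook rows k k ≡ 2 * hook rows k (suc z))
             (trans (rowIndex-mirror s<c s∉) (cong suc gaps-s≡i)) (sym z≡gaps-c)
             (mirror-row-doubles s<c s∉)

diagonal-hook-doubles : ∀ {c l} → 4 ≤ c → InUbar (T (2 + c)) l → ∀ z → Cell (youngRows l) 1 (suc z) →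
  hook (youngRows l) 1 (suc z) ≡ c → ∀ i → 1 ≤ i → i ≤ z →
  Cell (youngRows l) i (suc z) × hook (youngRows l) i i ≡ 2 * hook (youngRows l) i (suc z)
diagonal-hook-doubles {l = []} _ (((_ , _ , () , _) , _) , _)
diagonal-hook-doubles {l = x ∷ xs} 4≤c ubar z (_ , _ , z<row) =
  Hooks.diagonal-hook (proj₁ (proj₁ (proj₁ ubar))) (largest-∈ x xs) (mirrorPaired 4≤c ubar) z<row

lemma3p8 : (k : ℕ) → 4 ≤ k → (l : List ℕ) → InUbar (T (2 * k ∸ 1)) l →
    (z : ℕ) → Cell (youngRows l) 1 (suc z) →
    hook (youngRows l) 1 (suc z) ≡ (2 * k ∸ 1) ∸ 2 →
    (i : ℕ) → 1 ≤ i → i ≤ z →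
    Cell (youngRows l) i (suc z) ×
    hook (youngRows l) i i ≡ 2 * hook (youngRows l) i (suc z)
lemma3p8 k 4≤k l ubar = diagonal-hook-doubles 4≤n∸2 (subst (λ n → InUbar (T n) l) (sym (m+[n∸m]≡n 2≤n)) ubar)
  where
  7≤n : 7 ≤ 2 * k ∸ 1
  7≤n = ∸-monoˡ-≤ 1 (*-monoʳ-≤ 2 4≤k)
  2≤n : 2 ≤ 2 * k ∸ 1
  2≤n = ≤-trans (s≤s (s≤s z≤n)) 7≤n
  4≤n∸2 : 4 ≤ (2 * k ∸ 1) ∸ 2
  4≤n∸2 = ≤-trans (n≤1+n 4) (∸-monoˡ-≤ 2 7≤n)
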